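{- Let $k\geq 2$ be an integer, $\lambda$ a positive integer, and $a_{k,n}^{k}$ the $k$-th sequence of generalized order-$k$ numbers defined in the context. For $n\ge1$ let $B_{k,n}=(b_{st})$ be the $n\times n$ lower Hessenberg matrix with \[ b_{st}=\begin{cases}-1&\text{if } t=s+1,\\ 1 & \text{if } 1\le s-t\le k-1,\\ \lambda&\text{if } s=t,\\ 0&\text{otherwise.}\end{cases} \] Then $\det(B_{k,n})=a_{k,n+1}^{k}$ for all $n\ge1$.
   Context: For a positive integer $k$ and a positive integer $\lambda$, the $k$ sequences of generalized order-$k$ numbers are defined as follows: for each $1\le i\le k$, the sequence $(a_{k,n}^{i})_{n\ge 1-k}$ has initial values $a_{k,n}^{i}=1$ if $i=1-n$ and $a_{k,n}^{i}=0$ otherwise, for $1-k\le n\le 0$, and satisfies $a_{k,n}^{i}=\lambda a_{k,n-1}^{i}+a_{k,n-2}^{i}+\cdots+a_{k,n-k}^{i}$ for $n\ge 1$. The $k$-th sequence is the one with $i=k$. -}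

module Defs where

open import Data.Nat as ℕ using (ℕ; zero; suc; _≤?_; _<?_)
open import Data.Nat.Properties using ()
open import Data.Integer as ℤ using (ℤ; +_; -_)
open import Data.Fin using (Fin; zero; suc; toℕ; punchIn)
open import Data.List using (List; []; _∷_; take; drop)
open import Data.Nat.ListAction using (sum)
open import Relation.Nullary using (yes; no)

-- We use the shifted index j = n + (k - 1) ≥ 0 for n ≥ 1 - k, i.e.
-- a^i_{k,n} = gen k lam i (n + k - 1).
-- Initial values (0 ≤ j < k, i.e. 1-k ≤ n ≤ 0): 1 if i = 1 - n, i.e.
-- i + j = k, and 0 otherwise.

initVal : (k i j : ℕ) → ℕ
initVal k i j with i ℕ.+ j ℕ.≟ k
... | yes _ = 1
... | no  _ = 0

-- history k lam i j = [A j , A (j-1) , ... , A 0]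
history : (k lam i : ℕ) → ℕ → List ℕ
history k lam i zero = initVal k i zero ∷ []
history k lam i (suc j) with suc j <? k
... | yes _ = initVal k i (suc j) ∷ history k lam i j
... | no  _ = next (history k lam i j) ∷ history k lam i j
  where
  next : List ℕ → ℕ
  next [] = 0
  next (x ∷ xs) = lam ℕ.* x ℕ.+ sum (take (k ℕ.∸ 1) xs)

gen : (k lam i j : ℕ) → ℕ
gen k lam i j with history k lam i j
... | [] = 0
... | x ∷ _ = x

a : (k lam i n : ℕ) → ℕ
a k lam i n = gen k lam i (n ℕ.+ (k ℕ.∸ 1))

Matrix : ℕ → Set
Matrix n = Fin n → Fin n → ℤ

sumFin : (n : ℕ) → (Fin n → ℤ) → ℤ
sumFin zero f = + 0
sumFin (suc n) f = f zero ℤ.+ sumFin n (λ j → f (suc j))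

sign : ℕ → ℤ
sign zero = + 1
sign (suc m) = - sign m

det : (n : ℕ) → Matrix n → ℤ
det zero M = + 1
det (suc n) M =
  sumFin (suc n) (λ j → sign (toℕ j) ℤ.* (M zero j ℤ.* det n (λ s t → M (suc s) (punchIn j t))))

-- The lower Hessenberg matrix B_{k,n} (0-based indices s, t; only the
-- differences and equalities of indices matter).

B : (k lam n : ℕ) → Matrix n
B k lam n s t with toℕ t ℕ.≟ suc (toℕ s)
... | yes _ = - (+ 1)
... | no _ with toℕ t <? toℕ s
...   | yes _ with toℕ s ℕ.∸ toℕ t ≤? k ℕ.∸ 1
...     | yes _ = + 1
...     | no  _ = + 0
B k lam n s t | no _ | no _ with toℕ s ℕ.≟ toℕ t
...     | yes _ = + lam
...     | no  _ = + 0

{-# OPTIONS --safe #-}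
-- Expanding along the first row, whose only other nonzero entry is the −1 above the diagonal, and
-- iterating on the second minor (again Hessenberg, with its first column shifted up) gives
-- D (m + 1) = λ D m + D (m − 1) + ⋯ + D (m − k + 1) for D m = det B_{k,m}, with D 0 = 1 and D = 0 at
-- negative indices.  The order-k numbers obey the same recurrence, and their initial window of
-- k − 1 zeros followed by a_{1−k} = 1 yields a_1 = 1 = D 0 when k ≥ 2, so a_{m+1} = D m.
module Submission where

open import Defs
open import Data.Nat using (ℕ; suc; _≤_; _≥_)
open import Data.Integer using (+_)
open import Relation.Binary.PropositionalEquality using (_≡_)

open import Data.Nat as ℕ using (zero; z≤n; s≤s; _<_; _<?_; _≤?_; _≟_)
import Data.Nat.Properties as ℕ
open import Data.Integer as ℤ using (ℤ; -_; _+_; _*_; _-_)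
import Data.Integer.Properties as ℤ
open import Data.Fin using (Fin; zero; suc; toℕ; punchIn)
open import Data.List using (List; []; _∷_; take; map; _++_; replicate; length)
open import Data.List.Properties using (map-++; map-replicate)
open import Data.Nat.ListAction using (sum)
open import Function using (_∘_)
open import Relation.Nullary using (yes; no; ¬_; contradiction)
open import Relation.Binary.PropositionalEquality
  using (refl; sym; trans; cong; cong₂; module ≡-Reasoning)

open ≡-Reasoning

sumFin-cong : ∀ n {f g : Fin n → ℤ} → (∀ j → f j ≡ g j) → sumFin n f ≡ sumFin n g
sumFin-cong zero    f≡g = refl
sumFin-cong (suc n) f≡g = cong₂ _+_ (f≡g zero) (sumFin-cong n (λ j → f≡g (suc j)))

sumFin-zero : ∀ n {f : Fin n → ℤ} → (∀ j → f j ≡ + 0) → sumFin n f ≡ + 0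
sumFin-zero zero    f≡0 = refl
sumFin-zero (suc n) f≡0 = cong₂ _+_ (f≡0 zero) (sumFin-zero n (λ j → f≡0 (suc j)))

minor : ∀ {n} → Fin (suc n) → Matrix (suc n) → Matrix n
minor j M s t = M (suc s) (punchIn j t)

det-cong : ∀ n {M N : Matrix n} → (∀ s t → M s t ≡ N s t) → det n M ≡ det n N
det-cong zero    M≡N = refl
det-cong (suc n) M≡N = sumFin-cong (suc n) λ j →
  cong₂ (λ x y → sign (toℕ j) * (x * y))
        (M≡N zero j) (det-cong n (λ s t → M≡N (suc s) (punchIn j t)))

det-firstRow₂ : ∀ m (M : Matrix (suc (suc m))) → (∀ j → M zero (suc (suc j)) ≡ + 0) →
  det (suc (suc m)) M ≡
    M zero zero * det (suc m) (minor zero M) - M zero (suc zero) * det (suc m) (minor (suc zero) M)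
det-firstRow₂ m M row₀≡0 = cong₂ _+_
  (ℤ.*-identityˡ (M zero zero * det (suc m) (minor zero M)))
  (trans (cong₂ _+_ (ℤ.-1*i≡-i (M zero (suc zero) * det (suc m) (minor (suc zero) M)))
                    (sumFin-zero m vanishing))
         (ℤ.+-identityʳ _))
  where
  vanishing : ∀ j →
    sign (toℕ (suc (suc j))) * (M zero (suc (suc j)) * det (suc m) (minor (suc (suc j)) M)) ≡ + 0
  vanishing j rewrite row₀≡0 j = ℤ.*-zeroʳ (sign (toℕ (suc (suc j))))

-- hessenberg c f n is the n×n lower Hessenberg matrix with f (s − t) at (s, t) for t ≤ s and −1 on
-- the superdiagonal, except that its first column is c.

hessenberg : (c f : ℕ → ℤ) (n : ℕ) → Matrix n
hessenberg c f n       s       zero          = c (toℕ s)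
hessenberg c f (suc n) zero    (suc zero)    = - + 1
hessenberg c f (suc n) zero    (suc (suc t)) = + 0
hessenberg c f (suc n) (suc s) (suc t)       = hessenberg f f n s t

hessenbergDet : (ℕ → ℤ) → ℕ → ℤ
hessenbergDet f m = det m (hessenberg f f m)

hessenberg-superdiagonal : ∀ {n} f (s t : Fin n) → toℕ t ≡ suc (toℕ s) → hessenberg f f n s t ≡ - + 1
hessenberg-superdiagonal f zero    (suc zero)    _  = refl
hessenberg-superdiagonal f (suc s) (suc t)       eq = hessenberg-superdiagonal f s t (ℕ.suc-injective eq)

hessenberg-lower : ∀ {n} f (s t : Fin n) → toℕ t ≤ toℕ s → hessenberg f f n s t ≡ f (toℕ s ℕ.∸ toℕ t)
hessenberg-lower f s       zero    _         = refl
hessenberg-lower f (suc s) (suc t) (s≤s t≤s) = hessenberg-lower f s t t≤s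

hessenberg-upper : ∀ {n} f (s t : Fin n) → suc (suc (toℕ s)) ≤ toℕ t → hessenberg f f n s t ≡ + 0
hessenberg-upper f zero    (suc zero)    (s≤s ())
hessenberg-upper f zero    (suc (suc t)) _         = refl
hessenberg-upper f (suc s) (suc t)       (s≤s s<t) = hessenberg-upper f s t s<t

minor₁-hessenberg : ∀ m c f (s t : Fin (suc m)) →
  minor (suc zero) (hessenberg c f (suc (suc m))) s t ≡ hessenberg (λ d → c (suc d)) f (suc m) s t
minor₁-hessenberg m       c f s       zero          = refl
minor₁-hessenberg (suc m) c f zero    (suc zero)    = refl
minor₁-hessenberg (suc m) c f zero    (suc (suc t)) = refl
minor₁-hessenberg (suc m) c f (suc s) (suc t)       = refl

dot : (ℕ → ℤ) → List ℤ → ℤ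
dot c []       = + 0
dot c (x ∷ xs) = c 0 * x + dot (λ d → c (suc d)) xs

dot-++ : ∀ c xs ys → dot c (xs ++ ys) ≡ dot c xs + dot (λ d → c (length xs ℕ.+ d)) ys
dot-++ c []       ys = sym (ℤ.+-identityˡ _)
dot-++ c (x ∷ xs) ys = trans (cong (_+_ (c 0 * x)) (dot-++ (λ d → c (suc d)) xs ys))
                             (sym (ℤ.+-assoc (c 0 * x) _ _))

dot-replicate-zero : ∀ c r ys → dot c (replicate r (+ 0) ++ ys) ≡ dot (λ d → c (r ℕ.+ d)) ys
dot-replicate-zero c zero    ys = refl
dot-replicate-zero c (suc r) ys =
  trans (cong₂ _+_ (ℤ.*-zeroʳ (c 0)) refl)
        (trans (ℤ.+-identityˡ _) (dot-replicate-zero (λ d → c (suc d)) r ys))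

hessenbergDets : (ℕ → ℤ) → ℕ → List ℤ
hessenbergDets f zero    = []
hessenbergDets f (suc m) = hessenbergDet f m ∷ hessenbergDets f m

length-hessenbergDets : ∀ f m → length (hessenbergDets f m) ≡ m
length-hessenbergDets f zero    = refl
length-hessenbergDets f (suc m) = cong suc (length-hessenbergDets f m)

det-hessenberg : ∀ m c f → det (suc m) (hessenberg c f (suc m)) ≡ dot c (hessenbergDets f (suc m))
det-hessenberg zero    c f = cong₂ _+_ (ℤ.*-identityˡ (c 0 * + 1)) refl
det-hessenberg (suc m) c f = begin
  det (suc (suc m)) H
    ≡⟨ det-firstRow₂ m H (λ _ → refl) ⟩
  c 0 * hessenbergDet f (suc m) - - + 1 * det (suc m) (minor (suc zero) H)
    ≡⟨ cong (_+_ (c 0 * hessenbergDet f (suc m))) minor₁-term ⟩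
  c 0 * hessenbergDet f (suc m) + dot (λ d → c (suc d)) (hessenbergDets f (suc m))
    ∎
  where
  H : Matrix (suc (suc m))
  H = hessenberg c f (suc (suc m))
  minor₁-term :
    - (- + 1 * det (suc m) (minor (suc zero) H)) ≡ dot (λ d → c (suc d)) (hessenbergDets f (suc m))
  minor₁-term = begin
    - (- + 1 * det (suc m) (minor (suc zero) H))          ≡⟨ cong -_ (ℤ.-1*i≡-i _) ⟩
    - - det (suc m) (minor (suc zero) H)                  ≡⟨ ℤ.neg-involutive _ ⟩
    det (suc m) (minor (suc zero) H)                      ≡⟨ det-cong (suc m) (minor₁-hessenberg m c f) ⟩
    det (suc m) (hessenberg (λ d → c (suc d)) f (suc m))  ≡⟨ det-hessenberg m (λ d → c (suc d)) f ⟩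
    dot (λ d → c (suc d)) (hessenbergDets f (suc m))      ∎

ones : ℕ → ℕ → ℤ
ones zero    d       = + 0
ones (suc r) zero    = + 1
ones (suc r) (suc d) = ones r d

ones-< : ∀ r d → d < r → ones r d ≡ + 1
ones-< (suc r) zero    _         = refl
ones-< (suc r) (suc d) (s≤s d<r) = ones-< r d d<r

ones-≥ : ∀ r d → r ≤ d → ones r d ≡ + 0
ones-≥ zero    d       _         = refl
ones-≥ (suc r) (suc d) (s≤s r≤d) = ones-≥ r d r≤d

dot-ones : ∀ r xs → dot (ones r) (map +_ xs) ≡ + sum (take r xs)
dot-ones zero    []       = refl
dot-ones zero    (x ∷ xs) = trans (ℤ.+-identityˡ _) (dot-ones zero xs)
dot-ones (suc r) []       = refl
dot-ones (suc r) (x ∷ xs) = trans (cong₂ _+_ (ℤ.*-identityˡ (+ x)) (dot-ones r xs))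
                                  (sym (ℤ.pos-+ x (sum (take r xs))))

coefficient : (k lam : ℕ) → ℕ → ℤ
coefficient k lam zero    = + lam
coefficient k lam (suc d) = ones (k ℕ.∸ 1) d

coefficient-inside : ∀ k lam {d} → 0 < d → d ≤ k ℕ.∸ 1 → coefficient k lam d ≡ + 1
coefficient-inside k lam {suc d} _ d<k-1 = ones-< (k ℕ.∸ 1) d d<k-1

coefficient-outside : ∀ k lam {d} → 0 < d → ¬ d ≤ k ℕ.∸ 1 → coefficient k lam d ≡ + 0
coefficient-outside k lam {suc d} _ d≮k-1 = ones-≥ (k ℕ.∸ 1) d (ℕ.≮⇒≥ d≮k-1)

B≡hessenberg : ∀ k lam n (s t : Fin n) →
  B k lam n s t ≡ hessenberg (coefficient k lam) (coefficient k lam) n s t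
B≡hessenberg k lam n s t with toℕ t ≟ suc (toℕ s)
... | yes t≡1+s = sym (hessenberg-superdiagonal _ s t t≡1+s)
... | no t≢1+s with toℕ t <? toℕ s
...   | yes t<s with toℕ s ℕ.∸ toℕ t ≤? k ℕ.∸ 1
...     | yes s-t≤k-1 = sym (trans (hessenberg-lower _ s t (ℕ.<⇒≤ t<s))
                                   (coefficient-inside k lam (ℕ.m<n⇒0<n∸m t<s) s-t≤k-1))
...     | no  s-t≰k-1 = sym (trans (hessenberg-lower _ s t (ℕ.<⇒≤ t<s))
                                   (coefficient-outside k lam (ℕ.m<n⇒0<n∸m t<s) s-t≰k-1))
B≡hessenberg k lam n s t | no t≢1+s | no t≮s with toℕ s ≟ toℕ t
...     | yes s≡t = sym (trans (hessenberg-lower _ s t (ℕ.≤-reflexive (sym s≡t)))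
                               (cong (coefficient k lam)
                                     (trans (cong (ℕ._∸ toℕ t) s≡t) (ℕ.n∸n≡0 (toℕ t)))))
...     | no  s≢t = sym (hessenberg-upper _ s t
                           (ℕ.≤∧≢⇒< (ℕ.≤∧≢⇒< (ℕ.≮⇒≥ t≮s) s≢t) (λ t≡1+s → t≢1+s (sym t≡1+s))))

nextTerm : (k lam : ℕ) → List ℕ → ℕ
nextTerm k lam []       = 0
nextTerm k lam (x ∷ xs) = lam ℕ.* x ℕ.+ sum (take (k ℕ.∸ 1) xs)

nextTerm-dot : ∀ k lam xs → + nextTerm k lam xs ≡ dot (coefficient k lam) (map +_ xs)
nextTerm-dot k lam []       = refl
nextTerm-dot k lam (x ∷ xs) = trans (ℤ.pos-+ (lam ℕ.* x) _)
  (cong₂ _+_ (ℤ.pos-* lam x) (sym (dot-ones (k ℕ.∸ 1) xs)))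

history-step : ∀ k lam i j → ¬ suc j < k →
  history k lam i (suc j) ≡ nextTerm k lam (history k lam i j) ∷ history k lam i j
history-step k lam i j j+1≮k with suc j <? k
... | yes j+1<k = contradiction j+1<k j+1≮k
... | no _ with history k lam i j
...   | []     = refl
...   | x ∷ xs = refl

gen-head : ∀ {k lam i j x xs} → history k lam i j ≡ x ∷ xs → gen k lam i j ≡ x
gen-head eq rewrite eq = refl

initVal-zero : ∀ k → initVal k k 0 ≡ 1
initVal-zero k with k ℕ.+ 0 ≟ k
... | yes _    = refl
... | no  k≢k = contradiction (ℕ.+-identityʳ k) k≢k

initVal-suc : ∀ k r → initVal k k (suc r) ≡ 0
initVal-suc k r with k ℕ.+ suc r ≟ k
... | no  _   = refl
... | yes eq = contradiction (trans (sym (ℕ.+-suc k r)) eq) (ℕ.m≢1+m+n k ∘ sym)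

history-initial : ∀ k lam r → r < k → history k lam k r ≡ replicate r 0 ++ 1 ∷ []
history-initial k lam zero    _   = cong (_∷ []) (initVal-zero k)
history-initial k lam (suc r) r<k with suc r <? k
... | yes _   = cong₂ _∷_ (initVal-suc k r) (history-initial k lam r (ℕ.<-trans (ℕ.n<1+n r) r<k))
... | no  r≮k = contradiction r<k r≮k

initialWindow : ℕ → List ℤ
initialWindow k = replicate (k ℕ.∸ 1) (+ 0) ++ + 1 ∷ []

dot-initialWindow : ∀ k c → dot c (initialWindow k) ≡ c (k ℕ.∸ 1)
dot-initialWindow k c = begin
  dot c (initialWindow k)        ≡⟨ dot-replicate-zero c (k ℕ.∸ 1) (+ 1 ∷ []) ⟩
  c (k ℕ.∸ 1 ℕ.+ 0) * + 1 + + 0  ≡⟨ trans (ℤ.+-identityʳ _) (ℤ.*-identityʳ _) ⟩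
  c (k ℕ.∸ 1 ℕ.+ 0)              ≡⟨ cong c (ℕ.+-identityʳ _) ⟩
  c (k ℕ.∸ 1)                    ∎

module _ (k lam : ℕ) where

  private
    f : ℕ → ℤ
    f = coefficient k lam

    -- terms m = [ a_m , … , a_{1−k} ]
    terms : ℕ → List ℕ
    terms m = history k lam k (m ℕ.+ (k ℕ.∸ 1))

  beyond-window : ∀ m → ¬ suc (m ℕ.+ (k ℕ.∸ 1)) ≤ k ℕ.∸ 1
  beyond-window m = ℕ.≤⇒≯ (ℕ.m≤n+m (k ℕ.∸ 1) m)

  beyond-initial : ∀ m → ¬ suc (m ℕ.+ (k ℕ.∸ 1)) < k
  beyond-initial m m+k<k = beyond-window m (ℕ.∸-monoˡ-≤ 1 m+k<k)

  dot-hessenbergDets-boundary : 2 ≤ k → ∀ m →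
    dot f (hessenbergDets f m) + f (m ℕ.+ (k ℕ.∸ 1)) ≡ hessenbergDet f m
  dot-hessenbergDets-boundary (s≤s (s≤s _)) zero =
    trans (ℤ.+-identityˡ _) (coefficient-inside k lam (s≤s z≤n) ℕ.≤-refl)
  dot-hessenbergDets-boundary k≥2 (suc m) = trans
    (cong₂ _+_ (sym (det-hessenberg m f f)) (coefficient-outside k lam (s≤s z≤n) (beyond-window m)))
    (ℤ.+-identityʳ _)

  dot-hessenbergDets-initialWindow : 2 ≤ k → ∀ m →
    dot f (hessenbergDets f m ++ initialWindow k) ≡ hessenbergDet f m
  dot-hessenbergDets-initialWindow k≥2 m = begin
    dot f (hessenbergDets f m ++ initialWindow k)
      ≡⟨ dot-++ f (hessenbergDets f m) (initialWindow k) ⟩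
    dot f (hessenbergDets f m) + dot (λ d → f (length (hessenbergDets f m) ℕ.+ d)) (initialWindow k)
      ≡⟨ cong (_+_ (dot f (hessenbergDets f m))) (dot-initialWindow k _) ⟩
    dot f (hessenbergDets f m) + f (length (hessenbergDets f m) ℕ.+ (k ℕ.∸ 1))
      ≡⟨ cong (λ l → dot f (hessenbergDets f m) + f (l ℕ.+ (k ℕ.∸ 1))) (length-hessenbergDets f m) ⟩
    dot f (hessenbergDets f m) + f (m ℕ.+ (k ℕ.∸ 1))
      ≡⟨ dot-hessenbergDets-boundary k≥2 m ⟩
    hessenbergDet f m ∎

  mutual
    terms-hessenbergDets : 2 ≤ k → ∀ m → map +_ (terms m) ≡ hessenbergDets f m ++ initialWindow k
    terms-hessenbergDets (s≤s (s≤s _)) zero = begin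
      map +_ (history k lam k (k ℕ.∸ 1))
        ≡⟨ cong (λ xs → map +_ xs) (history-initial k lam (k ℕ.∸ 1) (ℕ.n<1+n _)) ⟩
      map +_ (replicate (k ℕ.∸ 1) 0 ++ 1 ∷ [])
        ≡⟨ map-++ (λ n → + n) (replicate (k ℕ.∸ 1) 0) (1 ∷ []) ⟩
      map +_ (replicate (k ℕ.∸ 1) 0) ++ + 1 ∷ []
        ≡⟨ cong (_++ + 1 ∷ []) (map-replicate (λ n → + n) (k ℕ.∸ 1) 0) ⟩
      initialWindow k
        ∎
    terms-hessenbergDets k≥2 (suc m) = begin
      map +_ (terms (suc m))
        ≡⟨ cong (λ xs → map +_ xs) (history-step k lam k (m ℕ.+ (k ℕ.∸ 1)) (beyond-initial m)) ⟩
      + nextTerm k lam (terms m) ∷ map +_ (terms m)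
        ≡⟨ cong₂ _∷_ (nextTerm-terms k≥2 m) (terms-hessenbergDets k≥2 m) ⟩
      hessenbergDets f (suc m) ++ initialWindow k ∎

    nextTerm-terms : 2 ≤ k → ∀ m → + nextTerm k lam (terms m) ≡ hessenbergDet f m
    nextTerm-terms k≥2 m = begin
      + nextTerm k lam (terms m)                     ≡⟨ nextTerm-dot k lam (terms m) ⟩
      dot f (map +_ (terms m))                       ≡⟨ cong (dot f) (terms-hessenbergDets k≥2 m) ⟩
      dot f (hessenbergDets f m ++ initialWindow k)  ≡⟨ dot-hessenbergDets-initialWindow k≥2 m ⟩
      hessenbergDet f m                              ∎

  a≡hessenbergDet : 2 ≤ k → ∀ n → + a k lam k (suc n) ≡ hessenbergDet f n
  a≡hessenbergDet k≥2 n =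
    trans (cong +_ (gen-head (history-step k lam k (n ℕ.+ (k ℕ.∸ 1)) (beyond-initial n))))
          (nextTerm-terms k≥2 n)

theorem1p9 : (k lam : ℕ) → k ≥ 2 → lam ≥ 1 → (n : ℕ) → n ≥ 1 →
    det n (B k lam n) ≡ + a k lam k (suc n)
theorem1p9 k lam k≥2 _ n _ = begin
  det n (B k lam n)                    ≡⟨ det-cong n (B≡hessenberg k lam n) ⟩
  hessenbergDet (coefficient k lam) n  ≡⟨ sym (a≡hessenbergDet k lam k≥2 n) ⟩
  + a k lam k (suc n)                  ∎
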